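{- Let $q$ be an odd prime and $y$ an integer such that neither $y$ nor $1+y$ is a multiple of $q$. Then $w_{q-1}^{(r)}(y)\equiv0\pmod{q}$ for every positive integer $r$ with $r\equiv1\pmod{q}$.
   Context: $w_{n}^{(r)}(y)=\sum_{k=0}^{n}\left\{{n\atop k}\right\}(r)_{k}\,y^{k}$, where $\left\{{n\atop k}\right\}$ are Stirling numbers of the second kind and $(x)_{k}=x(x+1)\cdots(x+k-1)$, $(x)_0=1$. -}

module Defs where

open import Data.Nat as ℕ using (ℕ; zero; suc)
open import Data.Integer using (ℤ; +_; _+_; _*_; _^_)

stirling2 : ℕ → ℕ → ℕ
stirling2 zero    zero    = 1
stirling2 zero    (suc k) = 0
stirling2 (suc n) zero    = 0
stirling2 (suc n) (suc k) = suc k ℕ.* stirling2 n (suc k) ℕ.+ stirling2 n k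

rising : ℤ → ℕ → ℤ
rising x zero    = + 1
rising x (suc k) = rising x k * (x + + k)

sumTo : ℕ → (ℕ → ℤ) → ℤ
sumTo zero    f = f 0
sumTo (suc m) f = sumTo m f + f (suc m)

w : ℕ → ℤ → ℤ → ℤ
w n r y = sumTo n (λ k → + stirling2 n k * rising r k * y ^ k)

{-# OPTIONS --safe #-}
-- Modulo q the rising factorial (r)ₖ is k!, since r ≡ 1, and S(n,k)·k! is the k-th forward
-- difference of xⁿ at 0. By Fermat, x^(q-1) agrees modulo q with the indicator of x > 0 on
-- 0, …, q-1, and the k-th difference of that indicator at 0 is (-1)^(k-1) for k ≥ 1. Hence
-- w ≡ y - y² + … - y^(q-1), and multiplying by 1 + y telescopes this to
-- y - (-1)^(q-1)·y^q ≡ y - y ≡ 0 (Fermat again, also for -1). Cancelling the unit 1 + y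
-- finishes the proof.
module Submission where

open import Defs
open import Data.Nat as ℕ using (ℕ; _∸_; _≤_)
open import Data.Nat.Primality using (Prime)
open import Data.Nat.Divisibility using () renaming (_∣_ to _∣ℕ_)
open import Data.Integer using (ℤ; +_; _+_)
open import Data.Integer.Divisibility using (_∣_)
open import Relation.Nullary using (¬_)

open import Data.Nat using (zero; suc; z≤n; s≤s; _<_)
import Data.Nat.Properties as ℕₚ
open import Data.Nat.Divisibility using (>⇒∤; m∣m*n)
open import Data.Nat.Primality using (euclidsLemma; ¬prime[0]; ¬prime[1])
open import Data.Nat.Combinatorics using (_C_; nCn≡1; nC1≡n; k>n⇒nCk≡0; nCk+nC[k+1]≡[n+1]C[k+1])
open import Data.Fin as Fin using (Fin; fromℕ; inject₁)
open import Data.Fin.Patterns using (0F)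
import Data.Fin.Properties as Finₚ
open import Data.Vec.Functional using (tail; init)
open import Data.Integer using (_*_; _-_; -_; _^_; -[1+_]; ∣_∣; 0ℤ; 1ℤ; -1ℤ)
import Data.Integer.Properties as ℤₚ
open import Data.Integer.Divisibility.Signed
  using (divides; ∣m∣n⇒∣m+n; ∣m⇒∣-m; ∣n⇒∣m*n; ∣m⇒∣m*n; ∣ᵤ⇒∣; ∣⇒∣ᵤ)
  renaming (_∣_ to _∣ₛ_)
open import Data.Integer.Tactic.RingSolver using (solve-∀)
import Algebra.Properties.CommutativeSemiring.Binomial ℤₚ.+-*-commutativeSemiring as Binomial
import Algebra.Properties.Semiring.Exp ℤₚ.+-*-semiring as Exp
import Algebra.Properties.Semiring.Mult ℤₚ.+-*-semiring as Mult
import Algebra.Properties.Semiring.Sum ℤₚ.+-*-semiring as Sum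
open import Data.Sum using (fromInj₂)
open import Data.Empty using (⊥-elim)
open import Function using (_∘_)
open import Level using (0ℓ)
open import Relation.Binary.Bundles using (Setoid)
import Relation.Binary.Reasoning.Setoid as SetoidReasoning
open import Relation.Binary.PropositionalEquality

private variable
  a b c e d : ℤ
  f g : ℕ → ℤ

-- Congruences modulo an integer

infix 4 _≡_mod_
data _≡_mod_ (a b d : ℤ) : Set where
  mod-by : d ∣ₛ a - b → a ≡ b mod d

mod-reflexive : a ≡ b → a ≡ b mod d
mod-reflexive {a} refl = mod-by (divides 0ℤ (ℤₚ.+-inverseʳ a))

mod-refl : ∀ a → a ≡ a mod d
mod-refl a = mod-reflexive refl

mod-sym : a ≡ b mod d → b ≡ a mod d
mod-sym {a} {b} (mod-by d∣a-b) = mod-by (subst (_ ∣ₛ_) (negate a b) (∣m⇒∣-m d∣a-b))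
  where
  negate : ∀ a b → - (a - b) ≡ b - a
  negate = solve-∀

mod-trans : a ≡ b mod d → b ≡ c mod d → a ≡ c mod d
mod-trans {a} {b} {_} {c} (mod-by d∣a-b) (mod-by d∣b-c) =
  mod-by (subst (_ ∣ₛ_) (chain a b c) (∣m∣n⇒∣m+n d∣a-b d∣b-c))
  where
  chain : ∀ a b c → (a - b) + (b - c) ≡ a - c
  chain = solve-∀

mod-setoid : ℤ → Setoid 0ℓ 0ℓ
mod-setoid d = record
  { Carrier       = ℤ
  ; _≈_           = λ a b → a ≡ b mod d
  ; isEquivalence = record { refl = mod-refl _ ; sym = mod-sym ; trans = mod-trans }
  }

module ≡-mod-Reasoning (d : ℤ) = SetoidReasoning (mod-setoid d)

∣⇒≡0-mod : d ∣ₛ a → a ≡ 0ℤ mod d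
∣⇒≡0-mod {a = a} = mod-by ∘ subst (_ ∣ₛ_) (sym (ℤₚ.+-identityʳ a))

≡0-mod⇒∣ : a ≡ 0ℤ mod d → d ∣ₛ a
≡0-mod⇒∣ {a} (mod-by d∣a-0) = subst (_ ∣ₛ_) (ℤₚ.+-identityʳ a) d∣a-0

+-cong-mod : a ≡ b mod d → c ≡ e mod d → a + c ≡ b + e mod d
+-cong-mod {a} {b} {_} {c} {e} (mod-by d∣a-b) (mod-by d∣c-e) =
  mod-by (subst (_ ∣ₛ_) (regroup a b c e) (∣m∣n⇒∣m+n d∣a-b d∣c-e))
  where
  regroup : ∀ a b c e → (a - b) + (c - e) ≡ (a + c) - (b + e)
  regroup = solve-∀

-‿cong-mod : a ≡ b mod d → - a ≡ - b mod d
-‿cong-mod {a} {b} (mod-by d∣a-b) = mod-by (subst (_ ∣ₛ_) (negate a b) (∣m⇒∣-m d∣a-b))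
  where
  negate : ∀ a b → - (a - b) ≡ - a - - b
  negate = solve-∀

*-cong-mod : a ≡ b mod d → c ≡ e mod d → a * c ≡ b * e mod d
*-cong-mod {a} {b} {_} {c} {e} (mod-by d∣a-b) (mod-by d∣c-e) =
  mod-by (subst (_ ∣ₛ_) (regroup a b c e)
    (∣m∣n⇒∣m+n (∣m⇒∣m*n c d∣a-b) (∣n⇒∣m*n b d∣c-e)))
  where
  regroup : ∀ a b c e → (a - b) * c + b * (c - e) ≡ a * c - b * e
  regroup = solve-∀

+-cancelˡ-mod : c + a ≡ c + b mod d → a ≡ b mod d
+-cancelˡ-mod {c} {a} {b} (mod-by d∣ca-cb) = mod-by (subst (_ ∣ₛ_) (cancel c a b) d∣ca-cb)
  where
  cancel : ∀ c a b → (c + a) - (c + b) ≡ a - b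
  cancel = solve-∀

*-cancelˡ-mod : ∀ {p} → Prime p → ¬ (+ p ∣ c) → c * a ≡ c * b mod + p → a ≡ b mod + p
*-cancelˡ-mod {c} {a} {b} {p} pr p∤c (mod-by p∣ca-cb) =
  mod-by (∣ᵤ⇒∣ (fromInj₂ (⊥-elim ∘ p∤c) (euclidsLemma ∣ c ∣ ∣ a - b ∣ pr p∣∣c∣*∣a-b∣)))
  where
  factor : ∀ c a b → c * a - c * b ≡ c * (a - b)
  factor = solve-∀
  p∣∣c∣*∣a-b∣ : p ∣ℕ ∣ c ∣ ℕ.* ∣ a - b ∣
  p∣∣c∣*∣a-b∣ = subst (p ∣ℕ_) (ℤₚ.abs-* c (a - b))
    (∣⇒∣ᵤ (subst (_ ∣ₛ_) (factor c a b) p∣ca-cb))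

sumTo-cong-mod : ∀ m → (∀ k → k ≤ m → f k ≡ g k mod d) → sumTo m f ≡ sumTo m g mod d
sumTo-cong-mod zero    f≡g = f≡g 0 z≤n
sumTo-cong-mod (suc m) f≡g = +-cong-mod
  (sumTo-cong-mod m (λ k k≤m → f≡g k (ℕₚ.m≤n⇒m≤1+n k≤m)))
  (f≡g (suc m) ℕₚ.≤-refl)

rising-cong-mod : a ≡ b mod d → ∀ k → rising a k ≡ rising b k mod d
rising-cong-mod a≡b zero    = mod-refl 1ℤ
rising-cong-mod a≡b (suc k) = *-cong-mod (rising-cong-mod a≡b k) (+-cong-mod a≡b (mod-refl (+ k)))

-- Fermat's little theorem

[k+1]*[n+1]C[k+1]≡[n+1]*nCk : ∀ n k → suc k ℕ.* (suc n C suc k) ≡ suc n ℕ.* (n C k)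
[k+1]*[n+1]C[k+1]≡[n+1]*nCk zero    zero    = refl
[k+1]*[n+1]C[k+1]≡[n+1]*nCk zero    (suc k)
  rewrite k>n⇒nCk≡0 {1} {suc (suc k)} (s≤s (s≤s z≤n)) | k>n⇒nCk≡0 {0} {suc k} (s≤s z≤n)
  = ℕₚ.*-zeroʳ (suc (suc k))
[k+1]*[n+1]C[k+1]≡[n+1]*nCk (suc n) zero    =
  trans (ℕₚ.*-identityˡ _) (trans (nC1≡n (suc (suc n))) (sym (ℕₚ.*-identityʳ _)))
[k+1]*[n+1]C[k+1]≡[n+1]*nCk (suc n) (suc k) = begin
  suc (suc k) ℕ.* (suc (suc n) C suc (suc k))
    ≡⟨ cong (suc (suc k) ℕ.*_) (sym (nCk+nC[k+1]≡[n+1]C[k+1] (suc n) (suc k))) ⟩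
  suc (suc k) ℕ.* (x ℕ.+ y)
    ≡⟨ ℕₚ.*-distribˡ-+ (suc (suc k)) x y ⟩
  x ℕ.+ suc k ℕ.* x ℕ.+ suc (suc k) ℕ.* y
    ≡⟨ cong₂ (λ u v → x ℕ.+ u ℕ.+ v)
             ([k+1]*[n+1]C[k+1]≡[n+1]*nCk n k) ([k+1]*[n+1]C[k+1]≡[n+1]*nCk n (suc k)) ⟩
  x ℕ.+ suc n ℕ.* (n C k) ℕ.+ suc n ℕ.* (n C suc k)
    ≡⟨ ℕₚ.+-assoc x _ _ ⟩
  x ℕ.+ (suc n ℕ.* (n C k) ℕ.+ suc n ℕ.* (n C suc k))
    ≡⟨ cong (x ℕ.+_) (sym (ℕₚ.*-distribˡ-+ (suc n) (n C k) (n C suc k))) ⟩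
  x ℕ.+ suc n ℕ.* (n C k ℕ.+ n C suc k)
    ≡⟨ cong (λ u → x ℕ.+ suc n ℕ.* u) (nCk+nC[k+1]≡[n+1]C[k+1] n k) ⟩
  suc (suc n) ℕ.* (suc n C suc k) ∎
  where
  open ≡-Reasoning
  x = suc n C suc k
  y = suc n C suc (suc k)

p∣pCk : ∀ {p k} → Prime p → 0 < k → k < p → p ∣ℕ p C k
p∣pCk {suc n} {suc j} pr _ k<p = fromInj₂ (⊥-elim ∘ >⇒∤ k<p) (euclidsLemma (suc j) (suc n C suc j) pr
  (subst (suc n ∣ℕ_) (sym ([k+1]*[n+1]C[k+1]≡[n+1]*nCk n j)) (m∣m*n (n C j))))

Mult×≡* : ∀ n a → n Mult.× a ≡ + n * a
Mult×≡* zero    a = refl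
Mult×≡* (suc n) a = begin
  a + n Mult.× a      ≡⟨ cong (_+_ a) (Mult×≡* n a) ⟩
  a + + n * a         ≡⟨ cong (_+ + n * a) (ℤₚ.*-identityˡ a) ⟨
  1ℤ * a + + n * a    ≡⟨ ℤₚ.*-distribʳ-+ a 1ℤ (+ n) ⟨
  + suc n * a         ∎
  where open ≡-Reasoning

Exp^≡^ : ∀ a n → a Exp.^ n ≡ a ^ n
Exp^≡^ a zero    = refl
Exp^≡^ a (suc n) = cong (a *_) (Exp^≡^ a n)

∣-sum : ∀ {n} (t : Fin n → ℤ) → (∀ i → d ∣ₛ t i) → d ∣ₛ Sum.sum t
∣-sum {n = zero}  t d∣t = divides 0ℤ refl
∣-sum {n = suc n} t d∣t = ∣m∣n⇒∣m+n (d∣t 0F) (∣-sum (tail t) (d∣t ∘ Fin.suc))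

[1+a]^p≡1+a^p : ∀ {p} → Prime p → ∀ a → (1ℤ + a) ^ p ≡ 1ℤ + a ^ p mod + p
[1+a]^p≡1+a^p {zero} pr = ⊥-elim (¬prime[0] pr)
[1+a]^p≡1+a^p {suc m} pr a = begin
  (1ℤ + a) ^ p                                         ≡⟨ Exp^≡^ (1ℤ + a) p ⟨
  (1ℤ + a) Exp.^ p                                     ≡⟨ Binomial.theorem p 1ℤ a ⟩
  t 0F + Sum.sum (tail t)                              ≡⟨ cong (_+_ (t 0F)) (Sum.sum-init-last (tail t)) ⟩
  t 0F + (Sum.sum (init (tail t)) + t (fromℕ p))       ≈⟨ +-cong-mod (mod-reflexive first-term)
                                                            (+-cong-mod middle-terms (mod-reflexive last-term)) ⟩
  a ^ p + (0ℤ + 1ℤ)                                    ≡⟨ rearrange (a ^ p) ⟩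
  1ℤ + a ^ p                                           ∎
  where
  open ≡-mod-Reasoning (+ suc m)
  p = suc m
  t = Binomial.binomialTerm 1ℤ a p
  first-term : t 0F ≡ a ^ p
  first-term = trans (ℤₚ.+-identityʳ _) (trans (ℤₚ.*-identityˡ _) (Exp^≡^ a p))
  last-term : t (fromℕ p) ≡ 1ℤ
  last-term rewrite Finₚ.toℕ-fromℕ m | nCn≡1 p | ℕₚ.n∸n≡0 p =
    trans (ℤₚ.+-identityʳ _) (trans (ℤₚ.*-identityʳ _) (trans (Exp^≡^ 1ℤ p) (ℤₚ.^-zeroˡ p)))
  middle-terms : Sum.sum (init (tail t)) ≡ 0ℤ mod + p
  middle-terms = ∣⇒≡0-mod (∣-sum (init (tail t)) middle)
    where
    middle : ∀ i → + p ∣ₛ t (Fin.suc (inject₁ i))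
    middle i = subst (_ ∣ₛ_) (sym (Mult×≡* (p C k) (Binomial.binomial 1ℤ a p (Fin.suc (inject₁ i)))))
      (∣m⇒∣m*n _ (∣ᵤ⇒∣ {+ p} {+ (p C k)} (p∣pCk pr (s≤s z≤n) (s≤s (Finₚ.inject₁ℕ< i)))))
      where k = suc (Fin.toℕ (inject₁ i))
  rearrange : ∀ x → x + (0ℤ + 1ℤ) ≡ 1ℤ + x
  rearrange = solve-∀

fermat-step-up : ∀ {p} → Prime p → a ^ p ≡ a mod + p → (1ℤ + a) ^ p ≡ 1ℤ + a mod + p
fermat-step-up {a} pr aᵖ≡a = mod-trans ([1+a]^p≡1+a^p pr a) (+-cong-mod (mod-refl 1ℤ) aᵖ≡a)

fermat-step-down : ∀ {p} → Prime p → (1ℤ + a) ^ p ≡ 1ℤ + a mod + p → a ^ p ≡ a mod + p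
fermat-step-down {a} pr [1+a]ᵖ≡1+a =
  +-cancelˡ-mod {c = 1ℤ} (mod-trans (mod-sym ([1+a]^p≡1+a^p pr a)) [1+a]ᵖ≡1+a)

fermat : ∀ {p} → Prime p → ∀ a → a ^ p ≡ a mod + p
fermat {zero}  pr _              = ⊥-elim (¬prime[0] pr)
fermat {suc m} pr (+ zero)       = mod-refl 0ℤ
fermat {suc m} pr (+ suc n)      = fermat-step-up pr (fermat pr (+ n))
-- Downwards, 1ℤ + -[1+ suc n ] computes to -[1+ n ] and 1ℤ + -[1+ zero ] to + zero.
fermat {suc m} pr -[1+ zero ]    = fermat-step-down pr (fermat pr (+ zero))
fermat {suc m} pr -[1+ suc n ]   = fermat-step-down pr (fermat pr -[1+ n ])

fermat-∤ : ∀ {p} → Prime p → ¬ (+ p ∣ a) → a ^ (p ∸ 1) ≡ 1ℤ mod + p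
fermat-∤ {p = zero}  pr _   = ⊥-elim (¬prime[0] pr)
fermat-∤ {a} {suc m} pr p∤a =
  *-cancelˡ-mod {c = a} pr p∤a (mod-trans (fermat pr a) (mod-reflexive (sym (ℤₚ.*-identityʳ a))))

-- Forward differences

Δ : ℕ → (ℕ → ℤ) → ℕ → ℤ
Δ zero    f x = f x
Δ (suc k) f x = Δ k f (suc x) - Δ k f x

Δ-suc : ∀ k f x → Δ k f (suc x) ≡ Δ k (f ∘ suc) x
Δ-suc zero    f x = refl
Δ-suc (suc k) f x = cong₂ _-_ (Δ-suc k f (suc x)) (Δ-suc k f x)

Δ-const : ∀ c k x → Δ (suc k) (λ _ → c) x ≡ 0ℤ
Δ-const c zero    x = ℤₚ.+-inverseʳ c
Δ-const c (suc k) x = cong₂ _-_ (Δ-const c k (suc x)) (Δ-const c k x)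

Δ-cong-mod : ∀ k x → (∀ i → i ≤ x ℕ.+ k → f i ≡ g i mod d) → Δ k f x ≡ Δ k g x mod d
Δ-cong-mod zero    x f≡g = f≡g x (ℕₚ.m≤m+n x 0)
Δ-cong-mod (suc k) x f≡g = +-cong-mod
  (Δ-cong-mod k (suc x) (λ i i≤ → f≡g i (subst (i ≤_) (sym (ℕₚ.+-suc x k)) i≤)))
  (-‿cong-mod (Δ-cong-mod k x (λ i i≤ → f≡g i (ℕₚ.≤-trans i≤ (ℕₚ.+-monoʳ-≤ x (ℕₚ.n≤1+n k))))))

Δ-leibniz : ∀ k g x → Δ (suc k) (λ i → + i * g i) x ≡ + x * Δ (suc k) g x + + suc k * Δ k g (suc x)
Δ-leibniz zero    g x = first-difference (+ x) (g (suc x)) (g x)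
  where
  first-difference : ∀ x u v → (1ℤ + x) * u - x * v ≡ x * (u - v) + 1ℤ * u
  first-difference = solve-∀
Δ-leibniz (suc k) g x = trans (cong₂ _-_ (Δ-leibniz k g (suc x)) (Δ-leibniz k g x))
  (regroup (+ x) (+ k) (Δ k g (suc (suc x))) (Δ k g (suc x)) (Δ k g x))
  where
  regroup : ∀ x k u v w → ((1ℤ + x) * (u - v) + (1ℤ + k) * u) - (x * (v - w) + (1ℤ + k) * v)
                        ≡ x * ((u - v) - (v - w)) + (1ℤ + (1ℤ + k)) * (u - v)
  regroup = solve-∀

-- The Leibniz rule at 0 reads Δᵏ⁺¹xⁿ⁺¹(0) = (k+1)·Δᵏxⁿ(1) = (k+1)·(Δᵏ⁺¹xⁿ(0) + Δᵏxⁿ(0)),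
-- which is the recurrence of S(n,k)·k!.
stirling2-as-Δ : ∀ n k → + stirling2 n k * rising 1ℤ k ≡ Δ k (λ x → (+ x) ^ n) 0
stirling2-as-Δ zero    zero    = refl
stirling2-as-Δ zero    (suc k) = sym (Δ-const 1ℤ k 0)
stirling2-as-Δ (suc n) zero    = refl
stirling2-as-Δ (suc n) (suc k) = begin
  + (suc k ℕ.* S₁ ℕ.+ S₀) * (R * + suc k)
    ≡⟨ cong (_* (R * + suc k)) (trans (ℤₚ.pos-+ (suc k ℕ.* S₁) S₀)
                                      (cong (_+ + S₀) (ℤₚ.pos-* (suc k) S₁))) ⟩
  (+ suc k * + S₁ + + S₀) * (R * + suc k)
    ≡⟨ distribute (+ suc k) (+ S₁) (+ S₀) R ⟩
  + suc k * (+ S₁ * (R * + suc k) + + S₀ * R)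
    ≡⟨ cong (+ suc k *_) (cong₂ _+_ (stirling2-as-Δ n (suc k)) (stirling2-as-Δ n k)) ⟩
  + suc k * (Δ (suc k) xⁿ 0 + Δ k xⁿ 0)
    ≡⟨ collapse (+ suc k) (Δ k xⁿ 1) (Δ k xⁿ 0) ⟩
  0ℤ + + suc k * Δ k xⁿ 1
    ≡⟨ Δ-leibniz k xⁿ 0 ⟨
  Δ (suc k) (λ x → (+ x) ^ suc n) 0 ∎
  where
  open ≡-Reasoning
  S₁ = stirling2 n (suc k)
  S₀ = stirling2 n k
  R  = rising 1ℤ k
  xⁿ : ℕ → ℤ
  xⁿ x = (+ x) ^ n
  distribute : ∀ k s₁ s₀ r → (k * s₁ + s₀) * (r * k) ≡ k * (s₁ * (r * k) + s₀ * r)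
  distribute = solve-∀
  collapse : ∀ k u v → k * ((u - v) + v) ≡ 0ℤ + k * u
  collapse = solve-∀

positive : ℕ → ℤ
positive zero    = 0ℤ
positive (suc _) = 1ℤ

Δ-positive : ∀ k → Δ (suc k) positive 0 ≡ -1ℤ ^ k
Δ-positive zero    = refl
Δ-positive (suc k) = begin
  Δ (suc k) positive 1 - Δ (suc k) positive 0 ≡⟨ cong₂ _-_ (Δ-suc (suc k) positive 0) (Δ-positive k) ⟩
  Δ (suc k) (λ _ → 1ℤ) 0 - -1ℤ ^ k            ≡⟨ cong (_- -1ℤ ^ k) (Δ-const 1ℤ k 0) ⟩
  0ℤ - -1ℤ ^ k                                 ≡⟨ ℤₚ.+-identityˡ _ ⟩
  - -1ℤ ^ k                                    ≡⟨ ℤₚ.-1*i≡-i _ ⟨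
  -1ℤ ^ suc k                                  ∎
  where open ≡-Reasoning

-- y - y² + y³ - … ± yᵐ, by Δ-positive
alternatingSum : ℤ → ℕ → ℤ
alternatingSum y m = sumTo m (λ k → Δ k positive 0 * y ^ k)

[1+y]*alternatingSum : ∀ y m → (1ℤ + y) * alternatingSum y m ≡ y - -1ℤ ^ m * y ^ suc m
[1+y]*alternatingSum y zero    = base y
  where
  base : ∀ y → (1ℤ + y) * (0ℤ * 1ℤ) ≡ y - 1ℤ * (y * 1ℤ)
  base = solve-∀
[1+y]*alternatingSum y (suc m) = begin
  (1ℤ + y) * (A + Δ (suc m) positive 0 * y ^ suc m)
    ≡⟨ cong (λ u → (1ℤ + y) * (A + u * y ^ suc m)) (Δ-positive m) ⟩
  (1ℤ + y) * (A + s * yᵐ⁺¹)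
    ≡⟨ ℤₚ.*-distribˡ-+ (1ℤ + y) A (s * yᵐ⁺¹) ⟩
  (1ℤ + y) * A + (1ℤ + y) * (s * yᵐ⁺¹)
    ≡⟨ cong (_+ (1ℤ + y) * (s * yᵐ⁺¹)) ([1+y]*alternatingSum y m) ⟩
  (y - s * yᵐ⁺¹) + (1ℤ + y) * (s * yᵐ⁺¹)
    ≡⟨ cancel y s yᵐ⁺¹ ⟩
  y - (-1ℤ * s) * (y * yᵐ⁺¹) ∎
  where
  open ≡-Reasoning
  A    = alternatingSum y m
  s    = -1ℤ ^ m
  yᵐ⁺¹ = y ^ suc m
  cancel : ∀ y s z → (y - s * z) + (1ℤ + y) * (s * z) ≡ y - (-1ℤ * s) * (y * z)
  cancel = solve-∀

power≡positive : ∀ {p} → Prime (suc p) → ∀ i → i ≤ p → (+ i) ^ p ≡ positive i mod + suc p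
power≡positive {zero}  pr = ⊥-elim (¬prime[1] pr)
power≡positive {suc m} pr zero    _     = mod-refl 0ℤ
power≡positive {suc m} pr (suc i) 1+i≤p = fermat-∤ {a = + suc i} pr (>⇒∤ (s≤s 1+i≤p))

w≡alternatingSum : ∀ {p r} y → Prime (suc p) → r ≡ 1ℤ mod + suc p →
                   w p r y ≡ alternatingSum y p mod + suc p
w≡alternatingSum {p} {r} y pr r≡1 =
  sumTo-cong-mod p (λ k k≤p → *-cong-mod (coefficient k k≤p) (mod-refl (y ^ k)))
  where
  open ≡-mod-Reasoning (+ suc p)
  coefficient : ∀ k → k ≤ p → + stirling2 p k * rising r k ≡ Δ k positive 0 mod + suc p
  coefficient k k≤p = begin
    + stirling2 p k * rising r k  ≈⟨ *-cong-mod (mod-refl (+ stirling2 p k)) (rising-cong-mod r≡1 k) ⟩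
    + stirling2 p k * rising 1ℤ k ≡⟨ stirling2-as-Δ p k ⟩
    Δ k (λ x → (+ x) ^ p) 0       ≈⟨ Δ-cong-mod k 0 (λ i i≤k → power≡positive pr i (ℕₚ.≤-trans i≤k k≤p)) ⟩
    Δ k positive 0                ∎

[1+y]*alternatingSum≡0 : ∀ {p} y → Prime (suc p) → (1ℤ + y) * alternatingSum y p ≡ 0ℤ mod + suc p
[1+y]*alternatingSum≡0 {zero}  y pr = ⊥-elim (¬prime[1] pr)
[1+y]*alternatingSum≡0 {suc m} y pr = begin
  (1ℤ + y) * alternatingSum y p ≡⟨ [1+y]*alternatingSum y p ⟩
  y - -1ℤ ^ p * y ^ suc p       ≈⟨ +-cong-mod (mod-refl y) (-‿cong-mod (*-cong-mod [-1]ᵖ≡1 (fermat pr y))) ⟩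
  y - 1ℤ * y                    ≡⟨ vanish y ⟩
  0ℤ                            ∎
  where
  open ≡-mod-Reasoning (+ suc (suc m))
  p = suc m
  [-1]ᵖ≡1 : -1ℤ ^ p ≡ 1ℤ mod + suc p
  [-1]ᵖ≡1 = fermat-∤ {a = -1ℤ} pr (>⇒∤ (s≤s (s≤s z≤n)))
  vanish : ∀ y → y - 1ℤ * y ≡ 0ℤ
  vanish = solve-∀

alternatingSum≡0 : ∀ {p} y → Prime (suc p) → ¬ (+ suc p ∣ 1ℤ + y) →
                   alternatingSum y p ≡ 0ℤ mod + suc p
alternatingSum≡0 y pr p∤1+y = *-cancelˡ-mod {c = 1ℤ + y} pr p∤1+y
  (mod-trans ([1+y]*alternatingSum≡0 y pr) (mod-reflexive (sym (ℤₚ.*-zeroʳ (1ℤ + y)))))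

theorem4p5 : (q : ℕ) → Prime q → ¬ (2 ∣ℕ q) → (y : ℤ) → ¬ ((+ q) ∣ y) → ¬ ((+ q) ∣ (+ 1 + y)) →
    (r : ℕ) → 1 ≤ r → q ∣ℕ (r ∸ 1) → (+ q) ∣ w (q ∸ 1) (+ r) y
theorem4p5 zero    pr = ⊥-elim (¬prime[0] pr)
theorem4p5 (suc p) _ _ _ _ _ zero () _
theorem4p5 (suc p) pr _ y _ q∤1+y (suc r) _ q∣r =
  ∣⇒∣ᵤ (≡0-mod⇒∣ (mod-trans (w≡alternatingSum y pr r≡1) (alternatingSum≡0 y pr q∤1+y)))
  where
  -- + suc r - 1ℤ computes to + r
  r≡1 : + suc r ≡ 1ℤ mod + suc p
  r≡1 = mod-by (∣ᵤ⇒∣ q∣r)
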